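{- Let $k$ be a positive integer. (i) If $k\equiv 2 \pmod 5$, then $va_3^{\equiv}(K_{4k+1,4k+1,4k+1})\leq \frac{12k+6}{5}$. (ii) If $k\equiv 3 \pmod 5$, then $va_3^{\equiv}(K_{4k+1,4k+1,4k+1})\leq \frac{12k+9}{5}$. (iii) If $k\equiv 4 \pmod 5$, then $va_3^{\equiv}(K_{4k+1,4k+1,4k+1})\leq \frac{12k+12}{5}$. (iv) If $k\equiv 0 \pmod 5$, then $va_3^{\equiv}(K_{4k+1,4k+1,4k+1})\leq \frac{12k+15}{5}$.
   Context: All graphs are finite and simple. A $t$-coloring of a graph $G$ is a map $f:V(G)\to\{1,\dots,t\}$, with color classes $V_i=\{v: f(v)=i\}$. It is equitable if $\big||V_i|-|V_j|\big|\le 1$ for all $i,j$. A $(t,k)$-tree-coloring of $G$ is a $t$-coloring such that every connected component of each induced subgraph $G[V_i]$ is a tree of maximum degree at most $k$; an equitable $(t,k)$-tree-coloring is a $(t,k)$-tree-coloring that is equitable. The strong equitable vertex $k$-arboricity $va_k^{\equiv}(G)$ is the smallest integer $t$ such that $G$ has an equitable $(t',k)$-tree-coloring for every integer $t'\ge t$. $K_{n,n,n}$ denotes the complete tripartite graph whose three partite sets each have exactly $n$ vertices. -}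

module Defs where

open import Data.Nat using (ℕ; zero; suc; _+_; _*_; _≤_)
open import Data.Bool using (Bool; true; false; if_then_else_; not)
open import Data.Fin using (Fin; zero; suc; inject₁; fromℕ; remQuot)
open import Data.Fin.Properties using () renaming (_≟_ to _≟ᶠ_)
open import Data.Product using (Σ; _×_; proj₁; ∃)
open import Relation.Nullary using (¬_)
open import Relation.Nullary.Decidable using (⌊_⌋)
open import Relation.Binary.PropositionalEquality using (_≡_)
open import Function.Definitions using (Injective)

record Graph : Set where
  field
    N      : ℕ
    adj    : Fin N → Fin N → Bool
    sym    : ∀ u v → adj u v ≡ adj v u
    irrefl : ∀ v → adj v v ≡ false
open Graph public

count : ∀ {n} → (Fin n → Bool) → ℕ
count {zero}  p = 0
count {suc n} p = (if p zero then 1 else 0) + count (λ i → p (suc i))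

Coloring : Graph → ℕ → Set
Coloring G t = Fin (N G) → Fin t

classSize : (G : Graph) {t : ℕ} → Coloring G t → Fin t → ℕ
classSize G f i = count (λ v → ⌊ f v ≟ᶠ i ⌋)

Equitable : (G : Graph) {t : ℕ} → Coloring G t → Set
Equitable G f = ∀ i j → classSize G f i ≤ suc (classSize G f j)

classDeg : (G : Graph) {t : ℕ} → Coloring G t → Fin (N G) → ℕ
classDeg G f v = count (λ w → if adj G v w then ⌊ f w ≟ᶠ f v ⌋ else false)

MonoCycle : (G : Graph) {t : ℕ} → Coloring G t → Set
MonoCycle G f =
  Σ ℕ λ m → Σ (Fin (suc (suc (suc m))) → Fin (N G)) λ c →
    Injective _≡_ _≡_ c ×
    (∀ j → f (c j) ≡ f (c zero)) ×
    (∀ (j : Fin (suc (suc m))) → adj G (c (inject₁ j)) (c (suc j)) ≡ true) ×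
    (adj G (c (fromℕ (suc (suc m)))) (c zero) ≡ true)

-- (t,k)-tree-coloring: every component of every G[V_i] is a tree of maximum
-- degree ≤ k, i.e. each G[V_i] is acyclic (a forest) and has max degree ≤ k.
TreeColoring : (G : Graph) (k : ℕ) {t : ℕ} → Coloring G t → Set
TreeColoring G k f = (¬ MonoCycle G f) × (∀ v → classDeg G f v ≤ k)

HasEqTreeColoring : Graph → ℕ → ℕ → Set
HasEqTreeColoring G k t = ∃ λ (f : Coloring G t) → Equitable G f × TreeColoring G k f

-- va_k^≡(G) ≤ m : since va_k^≡(G) is the least t such that G has an equitable
-- (t',k)-tree-coloring for all t' ≥ t, va_k^≡(G) ≤ m holds iff G has an
-- equitable (t',k)-tree-coloring for every t' ≥ m.
StrongEqVA≤ : Graph → ℕ → ℕ → Set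
StrongEqVA≤ G k m = ∀ t → m ≤ t → HasEqTreeColoring G k t

part : (n : ℕ) → Fin (3 * n) → Fin 3
part n v = proj₁ (remQuot {3} n v)

K3 : ℕ → Graph
K3 n = record
  { N = 3 * n
  ; adj = λ u v → not ⌊ part n u ≟ᶠ part n v ⌋
  ; sym = sym′
  ; irrefl = irr
  }
  where
  open import Relation.Nullary.Decidable using (yes; no)
  open import Relation.Binary.PropositionalEquality using (refl) renaming (sym to ≡sym)
  sym′ : ∀ u v → not ⌊ part n u ≟ᶠ part n v ⌋ ≡ not ⌊ part n v ≟ᶠ part n u ⌋
  sym′ u v with part n u ≟ᶠ part n v | part n v ≟ᶠ part n u
  ... | yes _ | yes _ = refl
  ... | no _  | no _  = refl
  ... | yes p | no q  = Data.Empty.⊥-elim (q (≡sym p)) where import Data.Empty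
  ... | no p  | yes q = Data.Empty.⊥-elim (p (≡sym q)) where import Data.Empty
  irr : ∀ v → not ⌊ part n v ≟ᶠ part n v ⌋ ≡ false
  irr v with part n v ≟ᶠ part n v
  ... | yes _ = refl
  ... | no q  = Data.Empty.⊥-elim (q refl) where import Data.Empty

-- Colour K_{n,n,n} by listing its vertices part after part and cutting the list into consecutive
-- blocks, all of size q or q + 1, so that the colouring is equitable.  A block inside one part is an
-- independent set, and a block straddling the boundary between two parts with a single vertex on
-- one side is a star K_{1,l}; for l ≤ 3 both kinds of class induce forests of maximum degree at
-- most 3.  Cutting every part on its own into c blocks is possible iff c q ≤ n ≤ c (q + 1); for
-- n = 4k + 1 this reaches every t ≥ 3 ⌈n/5⌉ except 3k + 1, 3k + 2, 6k + 1, 6k + 2 and, when 3 ∤ n,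
-- the two values just above 3 ⌊n/3⌋.  These are reached by letting a star straddle each of the two
-- part boundaries.  In each residue class of k mod 5 the claimed bound is 3 ⌈n/5⌉.

module Submission where

open import Defs hiding (sym)
open import Data.Bool using (Bool; true; false; if_then_else_; T)
open import Data.Empty using (⊥; ⊥-elim)
open import Data.Fin using (Fin; zero; suc; toℕ; fromℕ<; inject₁; fromℕ; remQuot)
open import Data.Fin.Properties using (toℕ<n; toℕ-fromℕ<; toℕ-injective; combine-remQuot; toℕ-combine)
  renaming (_≟_ to _≟ᶠ_)
open import Data.List using (List; []; _∷_; length; _++_; replicate)
open import Data.List.Properties using (length-++; length-replicate)
open import Data.List.Relation.Unary.All using (All; []; _∷_)
open import Data.List.Relation.Unary.All.Properties using (++⁺; replicate⁺)
open import Data.Nat using (ℕ; zero; suc; _+_; _*_; _∸_; _≤_; _<_; z≤n; s≤s; _<?_; _≤?_; _≡ᵇ_; NonZero)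
open import Data.Nat.ListAction using (sum)
open import Data.Nat.ListAction.Properties using (sum-++)
open import Data.Nat.Tactic.RingSolver using (solve-∀)
open import Data.Nat.DivMod using (_/_; _%_; m≡m%n+[m/n]*n; m%n<n; m%n≤m; m*n/n≡m)
open import Data.Nat.Divisibility using (m%n≡0⇒n∣m; ∣⇒≤)
open import Data.Nat.Properties
open import Data.Product using (∃; ∃₂; _×_; _,_; proj₁; proj₂)
open import Data.Sum using (_⊎_; inj₁; inj₂)
open import Data.Unit using (tt)
open import Function using (_∘_)
open import Relation.Nullary using (¬_; yes; no)
open import Relation.Nullary.Decidable using (⌊_⌋; toWitness; fromWitness; ⌊⌋-map′)
open import Relation.Binary.PropositionalEquality

indicator-mono : ∀ a b → (T a → T b) → (if a then 1 else 0) ≤ (if b then 1 else 0)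
indicator-mono false b a⇒b = z≤n
indicator-mono true true a⇒b = ≤-refl
indicator-mono true false a⇒b = ⊥-elim (a⇒b tt)

count-cong : ∀ {n} {P Q : Fin n → Bool} → (∀ v → P v ≡ Q v) → count P ≡ count Q
count-cong {zero} P≗Q = refl
count-cong {suc n} P≗Q = cong₂ (λ b m → (if b then 1 else 0) + m) (P≗Q zero) (count-cong (P≗Q ∘ suc))

count-none : ∀ {n} {P : Fin n → Bool} → (∀ v → ¬ T (P v)) → count P ≡ 0
count-none {zero} none = refl
count-none {suc n} {P} none with P zero | none zero
... | false | _ = count-none (none ∘ suc)
... | true | ¬T = ⊥-elim (¬T tt)

count-mono : ∀ {n} {P Q : Fin n → Bool} → (∀ v → T (P v) → T (Q v)) → count P ≤ count Q
count-mono {zero} P⊆Q = z≤n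
count-mono {suc n} {P} {Q} P⊆Q = +-mono-≤ (indicator-mono (P zero) (Q zero) (P⊆Q zero)) (count-mono (P⊆Q ∘ suc))

count-< : ∀ {n} {P Q : Fin n → Bool} x → (∀ v → T (P v) → T (Q v)) → ¬ T (P x) → T (Q x) → count P < count Q
count-< {suc n} {P} {Q} zero P⊆Q ¬Px Qx with P zero | Q zero
... | false | true = s≤s (count-mono (P⊆Q ∘ suc))
... | true | _ = ⊥-elim (¬Px tt)
count-< {suc n} {P} {Q} (suc x) P⊆Q ¬Px Qx =
  +-mono-≤-< (indicator-mono (P zero) (Q zero) (P⊆Q zero)) (count-< x (P⊆Q ∘ suc) ¬Px Qx)

count-≟ : ∀ {n} (x : Fin n) → count (λ v → ⌊ v ≟ᶠ x ⌋) ≡ 1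
count-≟ {suc n} zero = cong suc (count-none {n} {λ i → ⌊ suc i ≟ᶠ zero ⌋} (λ _ ()))
count-≟ (suc x) = trans (count-cong (λ v → ⌊⌋-map′ _ _ (v ≟ᶠ x))) (count-≟ x)

count-≤1 : ∀ {n} {P : Fin n → Bool} x → (∀ v → T (P v) → v ≡ x) → count P ≤ 1
count-≤1 x only-x = ≤-trans (count-mono (λ v → fromWitness ∘ only-x v)) (≤-reflexive (count-≟ x))

data ClassShape (G : Graph) {t : ℕ} (f : Coloring G t) (c : Fin t) : Set where
  independent : (∀ {u w} → f u ≡ c → f w ≡ c → adj G u w ≡ false) → ClassShape G f c
  smallStar : ∀ x → f x ≡ c → classSize G f c ≤ 4 →
    (∀ {u w} → f u ≡ c → f w ≡ c → u ≢ x → w ≢ x → adj G u w ≡ false) → ClassShape G f c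

true≢false : true ≢ false
true≢false ()

module _ {G : Graph} {t : ℕ} {f : Coloring G t} where

  classNeighbour : Fin (N G) → Fin (N G) → Bool
  classNeighbour v w = if adj G v w then ⌊ f w ≟ᶠ f v ⌋ else false

  neighbour-in-class : ∀ {v w} → T (classNeighbour v w) → adj G v w ≡ true × f w ≡ f v
  neighbour-in-class {v} {w} h with adj G v w
  ... | true = refl , toWitness h

  not-own-neighbour : ∀ v → ¬ T (classNeighbour v v)
  not-own-neighbour v h = true≢false (trans (sym (proj₁ (neighbour-in-class h))) (irrefl G v))

  classDeg≤3 : ∀ {v} → ClassShape G f (f v) → classDeg G f v ≤ 3
  classDeg≤3 {v} (independent noEdge) = ≤-trans (≤-reflexive (count-none {P = classNeighbour v} λ w h →
    let (vw , fw≡fv) = neighbour-in-class h in true≢false (trans (sym vw) (noEdge refl fw≡fv)))) z≤n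
  classDeg≤3 {v} (smallStar x fx≡c size≤4 leaves) with v ≟ᶠ x
  ... | yes refl = ≤-pred (≤-trans neighbours<class size≤4)
    where
    neighbours<class : classDeg G f v < classSize G f (f v)
    neighbours<class = count-< {P = classNeighbour v} v (λ w → fromWitness ∘ proj₂ ∘ neighbour-in-class)
                         (not-own-neighbour v) (fromWitness refl)
  ... | no v≢x = ≤-trans (count-≤1 x only-centre) (s≤s z≤n)
    where
    only-centre : ∀ w → T (classNeighbour v w) → w ≡ x
    only-centre w h with w ≟ᶠ x
    ... | yes w≡x = w≡x
    ... | no w≢x = let (vw , fw≡fv) = neighbour-in-class h in
      ⊥-elim (true≢false (trans (sym vw) (leaves refl fw≡fv v≢x w≢x)))

  edge-touches-centre : ∀ {c} x →
    (∀ {u w} → f u ≡ c → f w ≡ c → u ≢ x → w ≢ x → adj G u w ≡ false) →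
    ∀ {u w} → f u ≡ c → f w ≡ c → adj G u w ≡ true → u ≡ x ⊎ w ≡ x
  edge-touches-centre x leaves {u} {w} fu fw uw with u ≟ᶠ x | w ≟ᶠ x
  ... | yes u≡x | _ = inj₁ u≡x
  ... | no _ | yes w≡x = inj₂ w≡x
  ... | no u≢x | no w≢x = ⊥-elim (true≢false (trans (sym uw) (leaves fu fw u≢x w≢x)))

  edge-leaving-third : ∀ m (c : Fin (suc (suc (suc m))) → Fin (N G)) →
    (∀ (j : Fin (suc (suc m))) → adj G (c (inject₁ j)) (c (suc j)) ≡ true) →
    adj G (c (fromℕ (suc (suc m)))) (c zero) ≡ true →
    ∃ λ i → adj G (c (suc (suc zero))) (c i) ≡ true × i ≢ suc zero
  edge-leaving-third zero c path closing = zero , closing , λ ()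
  edge-leaving-third (suc m) c path closing = suc (suc (suc zero)) , path (suc (suc zero)) , λ ()

  classShapes-acyclic : (∀ c → ClassShape G f c) → ¬ MonoCycle G f
  classShapes-acyclic shape (m , c , inj , mono , path , closing) with shape (f (c zero))
  ... | independent noEdge = true≢false (trans (sym (path zero)) (noEdge refl (mono (suc zero))))
  ... | smallStar x _ _ leaves with edge-leaving-third m c path closing
  ... | i , third , i≢1 = centre-twice (touches (path zero)) (touches (path (suc zero))) (touches third)
    where
    touches : ∀ {a b} → adj G (c a) (c b) ≡ true → c a ≡ x ⊎ c b ≡ x
    touches {a} {b} = edge-touches-centre x leaves (mono a) (mono b)
    distinct : ∀ {a b} → a ≢ b → c a ≡ x → c b ≡ x → ⊥
    distinct a≢b ca≡x cb≡x = a≢b (inj (trans ca≡x (sym cb≡x)))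
    centre-twice : c zero ≡ x ⊎ c (suc zero) ≡ x → c (suc zero) ≡ x ⊎ c (suc (suc zero)) ≡ x →
      c (suc (suc zero)) ≡ x ⊎ c i ≡ x → ⊥
    centre-twice _ (inj₁ c₁≡x) (inj₁ c₂≡x) = distinct (λ ()) c₁≡x c₂≡x
    centre-twice _ (inj₁ c₁≡x) (inj₂ cᵢ≡x) = distinct i≢1 cᵢ≡x c₁≡x
    centre-twice (inj₁ c₀≡x) (inj₂ c₂≡x) _ = distinct (λ ()) c₀≡x c₂≡x
    centre-twice (inj₂ c₁≡x) (inj₂ c₂≡x) _ = distinct (λ ()) c₁≡x c₂≡x

  classShapes⇒treeColoring : (∀ c → ClassShape G f c) → TreeColoring G 3 f
  classShapes⇒treeColoring shape = classShapes-acyclic shape , λ v → classDeg≤3 (shape (f v))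

countBelow : ℕ → (ℕ → Bool) → ℕ
countBelow n P = count {n} (P ∘ toℕ)

countBelow-cong : ∀ n {P Q : ℕ → Bool} → (∀ j → j < n → P j ≡ Q j) → countBelow n P ≡ countBelow n Q
countBelow-cong zero P≗Q = refl
countBelow-cong (suc n) P≗Q =
  cong₂ (λ b m → (if b then 1 else 0) + m) (P≗Q 0 (s≤s z≤n))
        (countBelow-cong n (λ j j<n → P≗Q (suc j) (s≤s j<n)))

countBelow-+ : ∀ m n P → countBelow (m + n) P ≡ countBelow m P + countBelow n (λ j → P (m + j))
countBelow-+ zero n P = refl
countBelow-+ (suc m) n P =
  trans (cong ((if P 0 then 1 else 0) +_) (countBelow-+ m n (P ∘ suc))) (sym (+-assoc (if P 0 then 1 else 0) _ _))

countBelow-true : ∀ n → countBelow n (λ _ → true) ≡ n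
countBelow-true zero = refl
countBelow-true (suc n) = cong suc (countBelow-true n)

countBelow-false : ∀ n → countBelow n (λ _ → false) ≡ 0
countBelow-false n = count-none {n} {λ _ → false} (λ _ ())

blockOf : List ℕ → ℕ → ℕ
blockOf [] j = 0
blockOf (s ∷ ss) j with j <? s
... | yes _ = 0
... | no _ = suc (blockOf ss (j ∸ s))

blockStart : List ℕ → ℕ → ℕ
blockStart [] i = 0
blockStart (s ∷ ss) zero = 0
blockStart (s ∷ ss) (suc i) = s + blockStart ss i

blockSize : List ℕ → ℕ → ℕ
blockSize [] i = 0
blockSize (s ∷ ss) zero = s
blockSize (s ∷ ss) (suc i) = blockSize ss i

InBlock : List ℕ → ℕ → ℕ → Set
InBlock ss i j = blockStart ss i ≤ j × j < blockStart ss i + blockSize ss i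

blockOf-head : ∀ {s} ss {j} → j < s → blockOf (s ∷ ss) j ≡ 0
blockOf-head {s} ss {j} j<s with j <? s
... | yes _ = refl
... | no j≮s = ⊥-elim (j≮s j<s)

blockOf-tail : ∀ s ss j → blockOf (s ∷ ss) (s + j) ≡ suc (blockOf ss j)
blockOf-tail s ss j with s + j <? s
... | yes s+j<s = ⊥-elim (m+n≮m s j s+j<s)
... | no _ = cong (suc ∘ blockOf ss) (m+n∸m≡n s j)

blockOf<length : ∀ ss {j} → j < sum ss → blockOf ss j < length ss
blockOf<length (s ∷ ss) {j} j<sum with j <? s
... | yes _ = s≤s z≤n
... | no j≮s =
  s≤s (blockOf<length ss (+-cancelˡ-< s _ _ (subst (_< s + sum ss) (sym (m+[n∸m]≡n (≮⇒≥ j≮s))) j<sum)))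

InBlock-tail : ∀ s ss i j → InBlock ss i j → InBlock (s ∷ ss) (suc i) (s + j)
InBlock-tail s ss i j (start≤j , j<end) =
  +-monoʳ-≤ s start≤j , subst (s + j <_) (sym (+-assoc s _ _)) (+-monoʳ-< s j<end)

InBlock-untail : ∀ s ss i j → InBlock (s ∷ ss) (suc i) (s + j) → InBlock ss i j
InBlock-untail s ss i j (start≤ , <end) =
  +-cancelˡ-≤ s _ _ start≤ , +-cancelˡ-< s _ _ (subst (s + j <_) (+-assoc s _ _) <end)

blockOf-sound : ∀ ss {j} → j < sum ss → InBlock ss (blockOf ss j) j
blockOf-sound (s ∷ ss) {j} j<sum with j <? s
... | yes j<s = z≤n , j<s
... | no j≮s = subst (InBlock (s ∷ ss) _) s+[j∸s]≡j
                 (InBlock-tail s ss _ (j ∸ s) (blockOf-sound ss (+-cancelˡ-< s _ _ j∸s<)))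
  where
  s+[j∸s]≡j : s + (j ∸ s) ≡ j
  s+[j∸s]≡j = m+[n∸m]≡n (≮⇒≥ j≮s)
  j∸s< : s + (j ∸ s) < s + sum ss
  j∸s< = subst (_< s + sum ss) (sym s+[j∸s]≡j) j<sum

blockOf-complete : ∀ ss i j → InBlock ss i j → blockOf ss j ≡ i
blockOf-complete (s ∷ ss) zero j (_ , j<s) = blockOf-head ss j<s
blockOf-complete (s ∷ ss) (suc i) j inBlock = begin
  blockOf (s ∷ ss) j              ≡⟨ cong (blockOf (s ∷ ss)) (sym s+[j∸s]≡j) ⟩
  blockOf (s ∷ ss) (s + (j ∸ s))  ≡⟨ blockOf-tail s ss (j ∸ s) ⟩
  suc (blockOf ss (j ∸ s))        ≡⟨ cong suc (blockOf-complete ss i (j ∸ s) (InBlock-untail s ss i _ shifted)) ⟩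
  suc i                           ∎
  where
  open ≡-Reasoning
  s+[j∸s]≡j : s + (j ∸ s) ≡ j
  s+[j∸s]≡j = m+[n∸m]≡n (≤-trans (m≤m+n s _) (proj₁ inBlock))
  shifted : InBlock (s ∷ ss) (suc i) (s + (j ∸ s))
  shifted = subst (InBlock (s ∷ ss) (suc i)) (sym s+[j∸s]≡j) inBlock

countBelow-blockOf : ∀ ss i → countBelow (sum ss) (λ j → blockOf ss j ≡ᵇ i) ≡ blockSize ss i
countBelow-blockOf [] i = refl
countBelow-blockOf (s ∷ ss) i = begin
  countBelow (s + sum ss) (λ j → blockOf (s ∷ ss) j ≡ᵇ i)
    ≡⟨ countBelow-+ s (sum ss) (λ j → blockOf (s ∷ ss) j ≡ᵇ i) ⟩
  countBelow s (λ j → blockOf (s ∷ ss) j ≡ᵇ i) + countBelow (sum ss) (λ j → blockOf (s ∷ ss) (s + j) ≡ᵇ i)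
    ≡⟨ cong₂ _+_ (countBelow-cong s (λ j j<s → cong (_≡ᵇ i) (blockOf-head ss j<s)))
                 (countBelow-cong (sum ss) (λ j _ → cong (_≡ᵇ i) (blockOf-tail s ss j))) ⟩
  countBelow s (λ _ → 0 ≡ᵇ i) + countBelow (sum ss) (λ j → suc (blockOf ss j) ≡ᵇ i)
    ≡⟨ by-index i ⟩
  blockSize (s ∷ ss) i ∎
  where
  open ≡-Reasoning
  by-index : ∀ i → countBelow s (λ _ → 0 ≡ᵇ i) + countBelow (sum ss) (λ j → suc (blockOf ss j) ≡ᵇ i)
                   ≡ blockSize (s ∷ ss) i
  by-index zero = trans (cong₂ _+_ (countBelow-true s) (countBelow-false (sum ss))) (+-identityʳ s)
  by-index (suc i) = trans (cong (_+ _) (countBelow-false s)) (countBelow-blockOf ss i)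

Near : ℕ → ℕ → Set
Near q z = z ≡ q ⊎ z ≡ suc q

near-≤ : ∀ {q a b} → Near q a → Near q b → a ≤ suc b
near-≤ (inj₁ refl) (inj₁ refl) = n≤1+n _
near-≤ (inj₁ refl) (inj₂ refl) = ≤-trans (n≤1+n _) (n≤1+n _)
near-≤ (inj₂ refl) (inj₁ refl) = ≤-refl
near-≤ (inj₂ refl) (inj₂ refl) = n≤1+n _

All-blockSize : ∀ {P : ℕ → Set} {ss} i → All P ss → i < length ss → P (blockSize ss i)
All-blockSize zero (p ∷ _) _ = p
All-blockSize (suc i) (_ ∷ ps) (s≤s i<len) = All-blockSize i ps i<len

blockEnd≤sum : ∀ ss {i} → i < length ss → blockStart ss i + blockSize ss i ≤ sum ss
blockEnd≤sum (s ∷ ss) {zero} _ = m≤m+n s (sum ss)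
blockEnd≤sum (s ∷ ss) {suc i} (s≤s i<len) =
  subst (_≤ s + sum ss) (sym (+-assoc s _ _)) (+-monoʳ-≤ s (blockEnd≤sum ss i<len))

⌊≟⌋≡≡ᵇ : ∀ {n} (a b : Fin n) → ⌊ a ≟ᶠ b ⌋ ≡ (toℕ a ≡ᵇ toℕ b)
⌊≟⌋≡≡ᵇ zero zero = refl
⌊≟⌋≡≡ᵇ zero (suc b) = refl
⌊≟⌋≡≡ᵇ (suc a) zero = refl
⌊≟⌋≡≡ᵇ (suc a) (suc b) = trans (⌊⌋-map′ _ _ (a ≟ᶠ b)) (⌊≟⌋≡≡ᵇ a b)

module BlockColouring (G : Graph) (ss : List ℕ) (sum≡N : sum ss ≡ N G) where

  colour : Coloring G (length ss)
  colour v = fromℕ< (blockOf<length ss (subst (toℕ v <_) (sym sum≡N) (toℕ<n v)))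

  toℕ-colour : ∀ v → toℕ (colour v) ≡ blockOf ss (toℕ v)
  toℕ-colour v = toℕ-fromℕ< _

  classSize-colour : ∀ c → classSize G colour c ≡ blockSize ss (toℕ c)
  classSize-colour c = begin
    classSize G colour c
      ≡⟨ count-cong (λ v → trans (⌊≟⌋≡≡ᵇ (colour v) c) (cong (_≡ᵇ toℕ c) (toℕ-colour v))) ⟩
    countBelow (N G) (λ j → blockOf ss j ≡ᵇ toℕ c)
      ≡⟨ cong (λ m → countBelow m (λ j → blockOf ss j ≡ᵇ toℕ c)) (sym sum≡N) ⟩
    countBelow (sum ss) (λ j → blockOf ss j ≡ᵇ toℕ c)
      ≡⟨ countBelow-blockOf ss (toℕ c) ⟩
    blockSize ss (toℕ c) ∎
    where open ≡-Reasoning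

  colour-sound : ∀ {v c} → colour v ≡ c → InBlock ss (toℕ c) (toℕ v)
  colour-sound {v} refl = subst (λ i → InBlock ss i (toℕ v)) (sym (toℕ-colour v))
    (blockOf-sound ss (subst (toℕ v <_) (sym sum≡N) (toℕ<n v)))

  colour-complete : ∀ {c j} (j<N : j < N G) → InBlock ss (toℕ c) j → colour (fromℕ< j<N) ≡ c
  colour-complete j<N inBlock =
    toℕ-injective (trans (toℕ-colour _) (trans (cong (blockOf ss) (toℕ-fromℕ< j<N)) (blockOf-complete ss _ _ inBlock)))

  colour-equitable : ∀ q → All (Near q) ss → Equitable G colour
  colour-equitable q near i j =
    subst₂ _≤_ (sym (classSize-colour i)) (cong suc (sym (classSize-colour j))) (near-≤ (nearAt i) (nearAt j))
    where
    nearAt : ∀ c → Near q (blockSize ss (toℕ c))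
    nearAt c = All-blockSize (toℕ c) near (toℕ<n c)

InPart : ℕ → ℕ → ℕ → Set
InPart n p j = p * n ≤ j × j < suc p * n

quotient-unique : ∀ {n a r p j} → r < n → j ≡ n * a + r → InPart n p j → a ≡ p
quotient-unique {n} {a} {r} {p} {j} r<n refl (pn≤j , j<[1+p]n) =
  ≤-antisym (≤-pred (*-cancelʳ-< n a (suc p) (≤-<-trans an≤j j<[1+p]n)))
            (≤-pred (*-cancelʳ-< n p (suc a) (≤-<-trans pn≤j j<[1+a]n)))
  where
  an≤j : a * n ≤ n * a + r
  an≤j = subst (_≤ n * a + r) (*-comm n a) (m≤m+n (n * a) r)
  j<[1+a]n : n * a + r < suc a * n
  j<[1+a]n = subst (n * a + r <_) (trans (+-comm (n * a) n) (cong (n +_) (*-comm n a))) (+-monoʳ-< (n * a) r<n)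

toℕ-part : ∀ {n p} (v : Fin (3 * n)) → InPart n p (toℕ v) → toℕ (part n v) ≡ p
toℕ-part {n} v = quotient-unique (toℕ<n (proj₂ (remQuot {3} n v)))
  (trans (cong toℕ (sym (combine-remQuot {3} n v))) (toℕ-combine (part n v) _))

inPart-nonadjacent : ∀ {n p u w} → InPart n p (toℕ u) → InPart n p (toℕ w) → adj (K3 n) u w ≡ false
inPart-nonadjacent {n} {p} {u} {w} u∈p w∈p with part n u ≟ᶠ part n w
... | yes _ = refl
... | no u≁w = ⊥-elim (u≁w (toℕ-injective (trans (toℕ-part {n} {p} u u∈p) (sym (toℕ-part {n} {p} w w∈p)))))

module _ {n t} {f : Coloring (K3 n) t} {c : Fin t} where

  independent-if-inPart : ∀ p → (∀ {u} → f u ≡ c → InPart n p (toℕ u)) → ClassShape (K3 n) f c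
  independent-if-inPart p inP = independent λ fu fw → inPart-nonadjacent {n} {p} (inP fu) (inP fw)

  smallStar-if-leavesInPart : ∀ p x → f x ≡ c → classSize (K3 n) f c ≤ 4 →
    (∀ {u} → f u ≡ c → u ≢ x → InPart n p (toℕ u)) → ClassShape (K3 n) f c
  smallStar-if-leavesInPart p x fx size≤4 inP =
    smallStar x fx size≤4 λ fu fw u≢x w≢x → inPart-nonadjacent {n} {p} (inP fu u≢x) (inP fw w≢x)

Within : ℕ → ℕ → ℕ → ℕ → Set
Within n p a b = p * n ≤ a × b ≤ suc p * n

within-inPart : ∀ {n p a b j} → Within n p a b → a ≤ j → j < b → InPart n p j
within-inPart (pn≤a , b≤) a≤j j<b = ≤-trans pn≤a a≤j , <-≤-trans j<b b≤

data BlockFits (n s z : ℕ) : Set where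
  insidePart : ∀ p → Within n p s (s + z) → BlockFits n s z
  starCentreFirst : ∀ p l → z ≡ suc l → l ≤ 3 → Within n p (suc s) (suc s + l) → BlockFits n s z
  starCentreLast : ∀ p l → z ≡ suc l → l ≤ 3 → Within n p s (s + l) → BlockFits n s z

data Fits (n : ℕ) : ℕ → List ℕ → Set where
  [] : ∀ {s} → Fits n s []
  _∷_ : ∀ {s z zs} → BlockFits n s z → Fits n (s + z) zs → Fits n s (z ∷ zs)

Fits-block : ∀ {n s} ss {i} → Fits n s ss → i < length ss → BlockFits n (s + blockStart ss i) (blockSize ss i)
Fits-block {n} {s} (z ∷ zs) {zero} (fz ∷ _) _ = subst (λ s′ → BlockFits n s′ z) (sym (+-identityʳ s)) fz
Fits-block {n} {s} (z ∷ zs) {suc i} (_ ∷ fzs) (s≤s i<len) =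
  subst (λ s′ → BlockFits n s′ (blockSize zs i)) (+-assoc s z _) (Fits-block zs fzs i<len)

module _ {n} {ss : List ℕ} (sum≡ : sum ss ≡ 3 * n) where
  open BlockColouring (K3 n) ss sum≡

  private
    start size : Fin (length ss) → ℕ
    start c = blockStart ss (toℕ c)
    size c = blockSize ss (toℕ c)

    vertexAt : ∀ c j → start c ≤ j → j < start c + size c → ∃ λ x → toℕ x ≡ j × colour x ≡ c
    vertexAt c j start≤j j<end = fromℕ< j<3n , toℕ-fromℕ< j<3n , colour-complete j<3n (start≤j , j<end)
      where
      j<3n : j < 3 * n
      j<3n = <-≤-trans j<end (subst (start c + size c ≤_) sum≡ (blockEnd≤sum ss (toℕ<n c)))

    starSize≤4 : ∀ c {l} → size c ≡ suc l → l ≤ 3 → classSize (K3 n) colour c ≤ 4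
    starSize≤4 c size≡ l≤3 = subst (_≤ 4) (sym (trans (classSize-colour c) size≡)) (s≤s l≤3)

    below-end : ∀ c {l u} → size c ≡ suc l → colour u ≡ c → toℕ u < suc (start c + l)
    below-end c {l} {u} size≡ fu =
      subst (toℕ u <_) (trans (cong (start c +_) size≡) (+-suc (start c) l)) (proj₂ (colour-sound fu))

  blockClassShape : ∀ c → BlockFits n (start c) (size c) → ClassShape (K3 n) colour c
  blockClassShape c (insidePart p within) =
    independent-if-inPart p λ fu → let (start≤u , u<end) = colour-sound fu in within-inPart {n} {p} within start≤u u<end
  blockClassShape c (starCentreFirst p l size≡ l≤3 within)
    with vertexAt c (start c) ≤-refl (subst (λ m → start c < start c + m) (sym size≡) (m<m+n (start c) (s≤s z≤n)))
  ... | x , x≡start , fx = smallStar-if-leavesInPart p x fx (starSize≤4 c size≡ l≤3) λ {u} fu u≢x →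
    within-inPart {n} {p} within
      (≤∧≢⇒< (proj₁ (colour-sound fu)) λ start≡u → u≢x (toℕ-injective (trans (sym start≡u) (sym x≡start))))
      (below-end c size≡ fu)
  blockClassShape c (starCentreLast p l size≡ l≤3 within)
    with vertexAt c (start c + l) (m≤m+n _ l)
                  (subst (start c + l <_) (cong (start c +_) (sym size≡)) (+-monoʳ-< (start c) (n<1+n l)))
  ... | x , x≡centre , fx = smallStar-if-leavesInPart p x fx (starSize≤4 c size≡ l≤3) λ {u} fu u≢x →
    within-inPart {n} {p} within (proj₁ (colour-sound fu))
      (≤∧≢⇒< (m<1+n⇒m≤n (below-end c size≡ fu)) λ u≡centre → u≢x (toℕ-injective (trans u≡centre (sym x≡centre))))

Fits-++ : ∀ {n s} xs {ys} → Fits n s xs → Fits n (s + sum xs) ys → Fits n s (xs ++ ys)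
Fits-++ {n} {s} [] {ys} _ fys = subst (λ o → Fits n o ys) (+-identityʳ s) fys
Fits-++ {n} {s} (x ∷ xs) {ys} (fx ∷ fxs) fys =
  fx ∷ Fits-++ xs fxs (subst (λ o → Fits n o ys) (sym (+-assoc s x (sum xs))) fys)

Fits-insidePart : ∀ {n s} p xs → Within n p s (s + sum xs) → Fits n s xs
Fits-insidePart p [] _ = []
Fits-insidePart {n} {s} p (x ∷ xs) (pn≤s , end≤) =
  insidePart p (pn≤s , ≤-trans (+-monoʳ-≤ s (m≤m+n x (sum xs))) end≤) ∷
  Fits-insidePart p xs (≤-trans pn≤s (m≤m+n s x) , subst (_≤ suc p * n) (sym (+-assoc s x (sum xs))) end≤)

-- How consecutive parts meet: either cleanly, or through one star block whose centre is the last
-- vertex of the left part and whose l leaves start the right part (centreBefore l), or the mirror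
-- image (centreAfter l).  leftUse and rightUse count the vertices the star takes from either side.
data Boundary : Set where
  cut : Boundary
  centreBefore : ℕ → Boundary
  centreAfter : ℕ → Boundary

leftUse rightUse : Boundary → ℕ
leftUse cut = 0
leftUse (centreBefore l) = 1
leftUse (centreAfter l) = l
rightUse cut = 0
rightUse (centreBefore l) = l
rightUse (centreAfter l) = 1

boundaryBlocks : Boundary → List ℕ
boundaryBlocks cut = []
boundaryBlocks (centreBefore l) = suc l ∷ []
boundaryBlocks (centreAfter l) = suc l ∷ []

starLeaves : Boundary → ℕ
starLeaves cut = 0
starLeaves (centreBefore l) = l
starLeaves (centreAfter l) = l

sum-boundaryBlocks : ∀ b → sum (boundaryBlocks b) ≡ leftUse b + rightUse b
sum-boundaryBlocks cut = refl
sum-boundaryBlocks (centreBefore l) = +-identityʳ (suc l)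
sum-boundaryBlocks (centreAfter l) = trans (+-identityʳ (suc l)) (+-comm 1 l)

Fits-boundary : ∀ {n p s} b → starLeaves b ≤ 3 → rightUse b ≤ n → p * n ≤ s → s + leftUse b ≡ suc p * n →
  Fits n s (boundaryBlocks b)
Fits-boundary cut _ _ _ _ = []
Fits-boundary {n} {p} {s} (centreBefore l) l≤3 l≤n _ s+1≡ =
  starCentreFirst (suc p) l refl l≤3 (≤-reflexive 1+s≡ , leaves-end≤) ∷ []
  where
  1+s≡ : suc p * n ≡ suc s
  1+s≡ = trans (sym s+1≡) (+-comm s 1)
  leaves-end≤ : suc s + l ≤ n + suc p * n
  leaves-end≤ = subst₂ _≤_ (cong (_+ l) 1+s≡) (+-comm (suc p * n) n) (+-monoʳ-≤ (suc p * n) l≤n)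
Fits-boundary {p = p} (centreAfter l) l≤3 _ pn≤s s+l≡ =
  starCentreLast p l refl l≤3 (pn≤s , ≤-reflexive s+l≡) ∷ []

-- ss cuts the positions from p n + r up to 3 n into admissible blocks, the first r vertices of part
-- p being already taken by the preceding boundary block.
record Layout (n p r : ℕ) (ss : List ℕ) : Set where
  constructor layout
  field
    fits : Fits n (p * n + r) ss
    fills : p * n + r + sum ss ≡ 3 * n
    carry≤n : r ≤ n

Layout-end : ∀ {n} → Layout n 3 0 []
Layout-end = layout [] (trans (+-identityʳ _) (+-identityʳ _)) z≤n

Layout-part : ∀ {n p r} S b {rest} → starLeaves b ≤ 3 → r + sum S + leftUse b ≡ n →
  Layout n (suc p) (rightUse b) rest → Layout n p r (S ++ boundaryBlocks b ++ rest)
Layout-part {n} {p} {r} S b {rest} leaves≤3 part≡n (layout fits rest≡ right≤n) = layout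
  (Fits-++ S (Fits-insidePart p S (pn≤ , S-end≤))
    (Fits-++ (boundaryBlocks b) (Fits-boundary {p = p} b leaves≤3 right≤n (≤-trans pn≤ (m≤m+n _ (sum S))) boundaryEnd)
      (subst (λ o → Fits n o rest) (sym restStart) fits)))
  total
  (subst (r ≤_) part≡n (≤-trans (m≤m+n r (sum S)) (m≤m+n _ (leftUse b))))
  where
  open ≡-Reasoning
  +-regroup : ∀ a b c d → a + b + c + d ≡ a + (b + c + d)
  +-regroup = solve-∀
  pn≤ : p * n ≤ p * n + r
  pn≤ = m≤m+n (p * n) r
  boundaryEnd : p * n + r + sum S + leftUse b ≡ suc p * n
  boundaryEnd = begin
    p * n + r + sum S + leftUse b    ≡⟨ +-regroup (p * n) r (sum S) (leftUse b) ⟩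
    p * n + (r + sum S + leftUse b)  ≡⟨ cong (p * n +_) part≡n ⟩
    p * n + n                        ≡⟨ +-comm (p * n) n ⟩
    suc p * n                        ∎
  S-end≤ : p * n + r + sum S ≤ suc p * n
  S-end≤ = subst (p * n + r + sum S ≤_) boundaryEnd (m≤m+n _ (leftUse b))
  restStart : p * n + r + sum S + sum (boundaryBlocks b) ≡ suc p * n + rightUse b
  restStart = begin
    p * n + r + sum S + sum (boundaryBlocks b)    ≡⟨ cong (p * n + r + sum S +_) (sum-boundaryBlocks b) ⟩
    p * n + r + sum S + (leftUse b + rightUse b)  ≡⟨ sym (+-assoc (p * n + r + sum S) _ _) ⟩
    p * n + r + sum S + leftUse b + rightUse b    ≡⟨ cong (_+ rightUse b) boundaryEnd ⟩
    suc p * n + rightUse b                        ∎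
  total : p * n + r + sum (S ++ boundaryBlocks b ++ rest) ≡ 3 * n
  total = begin
    p * n + r + sum (S ++ boundaryBlocks b ++ rest)
      ≡⟨ cong (p * n + r +_) (trans (sum-++ S _) (cong (sum S +_) (sum-++ (boundaryBlocks b) rest))) ⟩
    p * n + r + (sum S + (sum (boundaryBlocks b) + sum rest))
      ≡⟨ sym (trans (+-assoc (p * n + r + sum S) _ _) (+-assoc (p * n + r) (sum S) _)) ⟩
    p * n + r + sum S + sum (boundaryBlocks b) + sum rest
      ≡⟨ cong (_+ sum rest) restStart ⟩
    suc p * n + rightUse b + sum rest
      ≡⟨ rest≡ ⟩
    3 * n ∎

layout⇒equitableTreeColoring : ∀ {n q ss} → Layout n 0 0 ss → All (Near q) ss → HasEqTreeColoring (K3 n) 3 (length ss)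
layout⇒equitableTreeColoring {n} {q} {ss} (layout fits sum≡ _) near =
  colour , colour-equitable q near ,
  classShapes⇒treeColoring {f = colour} (λ c → blockClassShape {ss = ss} sum≡ c (Fits-block ss fits (toℕ<n c)))
  where open BlockColouring (K3 n) ss sum≡

record Tiling (q L c : ℕ) : Set where
  field
    blocks : List ℕ
    length≡ : length blocks ≡ c
    sum≡ : sum blocks ≡ L
    near : All (Near q) blocks

sum-replicate : ∀ m x → sum (replicate m x) ≡ m * x
sum-replicate zero x = refl
sum-replicate (suc m) x = cong (x +_) (sum-replicate m x)

length-++≡ : ∀ (xs : List ℕ) {ys a b} → length xs ≡ a → length ys ≡ b → length (xs ++ ys) ≡ a + b
length-++≡ xs refl refl = length-++ xs

replicateTiling : ∀ q x y → Tiling q (x * suc q + y * q) (x + y)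
replicateTiling q x y = record
  { blocks = replicate x (suc q) ++ replicate y q
  ; length≡ = length-++≡ (replicate x (suc q)) (length-replicate x) (length-replicate y)
  ; sum≡ = trans (sum-++ (replicate x (suc q)) _) (cong₂ _+_ (sum-replicate x (suc q)) (sum-replicate y q))
  ; near = ++⁺ (replicate⁺ x (inj₂ refl)) (replicate⁺ y (inj₁ refl))
  }

tiling : ∀ {q L c} → c * q ≤ L → L ≤ c * suc q → Tiling q L c
tiling {q} {L} {c} lower upper = subst₂ (Tiling q) L≡ x+y≡c (replicateTiling q x y)
  where
  open ≡-Reasoning
  x y : ℕ
  x = L ∸ c * q
  y = c ∸ x
  x+y≡c : x + y ≡ c
  x+y≡c = m+[n∸m]≡n (m≤n+o⇒m∸n≤o L (c * q) (subst (L ≤_) (trans (*-suc c q) (+-comm c (c * q))) upper))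
  regroup : ∀ x y q → x * suc q + y * q ≡ x + (x + y) * q
  regroup = solve-∀
  L≡ : x * suc q + y * q ≡ L
  L≡ = begin
    x * suc q + y * q  ≡⟨ regroup x y q ⟩
    x + (x + y) * q    ≡⟨ cong (λ m → x + m * q) x+y≡c ⟩
    x + c * q          ≡⟨ m∸n+n≡m lower ⟩
    L                  ∎

threePartColouring : ∀ {n q L₀ L₁ L₂ c₀ c₁ c₂} b₁ b₂ →
  starLeaves b₁ ≤ 3 → starLeaves b₂ ≤ 3 →
  All (Near q) (boundaryBlocks b₁) → All (Near q) (boundaryBlocks b₂) →
  Tiling q L₀ c₀ → Tiling q L₁ c₁ → Tiling q L₂ c₂ →
  L₀ + leftUse b₁ ≡ n → rightUse b₁ + L₁ + leftUse b₂ ≡ n → rightUse b₂ + L₂ ≡ n →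
  HasEqTreeColoring (K3 n) 3 (c₀ + (length (boundaryBlocks b₁) + (c₁ + (length (boundaryBlocks b₂) + c₂))))
threePartColouring {n} {q} {c₀ = c₀} {c₁} {c₂} b₁ b₂ leaves₁ leaves₂ near₁ near₂ T₀ T₁ T₂ part₀ part₁ part₂ =
  subst (HasEqTreeColoring (K3 n) 3) length≡t (layout⇒equitableTreeColoring ssLayout allNear)
  where
  open Tiling
  ss : List ℕ
  ss = blocks T₀ ++ boundaryBlocks b₁ ++ blocks T₁ ++ boundaryBlocks b₂ ++ blocks T₂ ++ []
  ssLayout : Layout n 0 0 ss
  ssLayout =
    Layout-part (blocks T₀) b₁ leaves₁ (trans (cong (_+ leftUse b₁) (sum≡ T₀)) part₀)
      (Layout-part (blocks T₁) b₂ leaves₂ (trans (cong (λ m → rightUse b₁ + m + leftUse b₂) (sum≡ T₁)) part₁)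
        (Layout-part (blocks T₂) cut z≤n (trans (+-identityʳ _) (trans (cong (rightUse b₂ +_) (sum≡ T₂)) part₂))
          Layout-end))
  allNear : All (Near q) ss
  allNear = ++⁺ (near T₀) (++⁺ near₁ (++⁺ (near T₁) (++⁺ near₂ (++⁺ (near T₂) []))))
  length≡t : length ss ≡ c₀ + (length (boundaryBlocks b₁) + (c₁ + (length (boundaryBlocks b₂) + c₂)))
  length≡t =
    length-++≡ (blocks T₀) (length≡ T₀) (length-++≡ (boundaryBlocks b₁) refl
      (length-++≡ (blocks T₁) (length≡ T₁) (length-++≡ (boundaryBlocks b₂) refl
        (trans (length-++≡ (blocks T₂) (length≡ T₂) refl) (+-identityʳ c₂)))))

_∈[_,_] : ℕ → ℕ → ℕ → Set
c ∈[ lo , hi ] = lo ≤ c × c ≤ hi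

sum-between : ∀ {lo hi lo′ hi′ t} → lo ≤ hi → lo′ ≤ hi′ → lo + lo′ ≤ t → t ≤ hi + hi′ →
  ∃₂ λ a b → a ∈[ lo , hi ] × b ∈[ lo′ , hi′ ] × a + b ≡ t
sum-between {lo} {hi} {lo′} {hi′} {t} lo≤hi lo′≤hi′ lower upper with t ≤? hi + lo′
... | yes t≤hi+lo′ =
  t ∸ lo′ , lo′ ,
  (m+n≤o⇒m≤o∸n lo lower , m≤n+o⇒m∸n≤o t lo′ (subst (t ≤_) (+-comm hi lo′) t≤hi+lo′)) ,
  (≤-refl , lo′≤hi′) ,
  m∸n+n≡m (m+n≤o⇒n≤o lo lower)
... | no t≰hi+lo′ =
  hi , t ∸ hi ,
  (lo≤hi , ≤-refl) ,
  (m+n≤o⇒m≤o∸n lo′ (subst (_≤ t) (+-comm hi lo′) hi+lo′≤t) , m≤n+o⇒m∸n≤o t hi upper) ,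
  m+[n∸m]≡n (m+n≤o⇒m≤o hi hi+lo′≤t)
  where
  hi+lo′≤t : hi + lo′ ≤ t
  hi+lo′≤t = <⇒≤ (≰⇒> t≰hi+lo′)

ThreeSummands : ℕ → ℕ → ℕ → Set
ThreeSummands lo hi t = ∃₂ λ c₀ c₁ → ∃ λ c₂ →
  c₀ ∈[ lo , hi ] × c₁ ∈[ lo , hi ] × c₂ ∈[ lo , hi ] × c₀ + (c₁ + c₂) ≡ t

split-in-three : ∀ {lo hi t} → lo * 3 ≤ t → t ≤ hi * 3 → ThreeSummands lo hi t
split-in-three {lo} {hi} {t} lower upper = split (*-cancelʳ-≤ lo hi 3 (≤-trans lower upper))
  where
  twice : ∀ m → m * 2 ≡ m + m
  twice m = trans (*-suc m 1) (cong (m +_) (*-identityʳ m))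
  split : lo ≤ hi → ThreeSummands lo hi t
  split lo≤hi
    with sum-between lo≤hi (*-monoˡ-≤ 2 lo≤hi) (subst (_≤ t) (*-suc lo 2) lower) (subst (t ≤_) (*-suc hi 2) upper)
  ... | c₀ , b , c₀∈ , (2lo≤b , b≤2hi) , c₀+b≡t
    with sum-between lo≤hi lo≤hi (subst (_≤ b) (twice lo) 2lo≤b) (subst (b ≤_) (twice hi) b≤2hi)
  ... | c₁ , c₂ , c₁∈ , c₂∈ , c₁+c₂≡b =
    c₀ , c₁ , c₂ , c₀∈ , c₁∈ , c₂∈ , trans (cong (c₀ +_) c₁+c₂≡b) c₀+b≡t

uniformColouring : ∀ {n} q {lo hi t} → n ≤ lo * suc q → hi * q ≤ n → lo * 3 ≤ t → t ≤ hi * 3 →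
  HasEqTreeColoring (K3 n) 3 t
uniformColouring {n} q {lo} {hi} n≤lo[1+q] hiq≤n lower upper with split-in-three lower upper
... | c₀ , c₁ , c₂ , c₀∈ , c₁∈ , c₂∈ , sum≡t =
  subst (HasEqTreeColoring (K3 n) 3) sum≡t
    (threePartColouring cut cut z≤n z≤n [] [] (tile c₀∈) (tile c₁∈) (tile c₂∈)
      (+-identityʳ n) (+-identityʳ n) refl)
  where
  tile : ∀ {c} → c ∈[ lo , hi ] → Tiling q n c
  tile (lo≤c , c≤hi) =
    tiling (≤-trans (*-monoˡ-≤ q c≤hi) hiq≤n) (≤-trans n≤lo[1+q] (*-monoˡ-≤ (suc q) lo≤c))

crossingColouring : ∀ {n t} q b₁ b₂ x₀ y₀ x₁ y₁ x₂ y₂ → starLeaves b₁ ≤ 3 → starLeaves b₂ ≤ 3 →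
  All (Near q) (boundaryBlocks b₁) → All (Near q) (boundaryBlocks b₂) →
  x₀ * suc q + y₀ * q + leftUse b₁ ≡ n →
  rightUse b₁ + (x₁ * suc q + y₁ * q) + leftUse b₂ ≡ n →
  rightUse b₂ + (x₂ * suc q + y₂ * q) ≡ n →
  x₀ + y₀ + (length (boundaryBlocks b₁) + (x₁ + y₁ + (length (boundaryBlocks b₂) + (x₂ + y₂)))) ≡ t →
  HasEqTreeColoring (K3 n) 3 t
crossingColouring {n} q b₁ b₂ x₀ y₀ x₁ y₁ x₂ y₂ leaves₁ leaves₂ near₁ near₂ part₀ part₁ part₂ total =
  subst (HasEqTreeColoring (K3 n) 3) total
    (threePartColouring b₁ b₂ leaves₁ leaves₂ near₁ near₂
      (replicateTiling q x₀ y₀) (replicateTiling q x₁ y₁) (replicateTiling q x₂ y₂) part₀ part₁ part₂)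

2≤3 : 2 ≤ 3
2≤3 = s≤s (s≤s z≤n)

m+n≡o⇒m≤o : ∀ {m o} n → m + n ≡ o → m ≤ o
m+n≡o⇒m≤o n refl = m≤m+n _ n

just-above : ∀ {a t} → a < t → t ≤ 2 + a → t ≡ 1 + a ⊎ t ≡ 2 + a
just-above {a} {t} a<t t≤2+a with t ≤? 1 + a
... | yes t≤1+a = inj₁ (≤-antisym t≤1+a a<t)
... | no t≰1+a = inj₂ (≤-antisym t≤2+a (≰⇒> t≰1+a))

colouring-just-above-3k : ∀ k → 2 ≤ k → ∀ t → k * 3 < t → t ≤ 2 + k * 3 →
  HasEqTreeColoring (K3 (4 * k + 1)) 3 t
colouring-just-above-3k (suc (suc m)) (s≤s (s≤s _)) t lower upper with just-above lower upper
... | inj₁ refl =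
  crossingColouring 3 (centreBefore 2) (centreAfter 3) (2 + m) 0 (suc m) 0 (2 + m) 0 2≤3 ≤-refl
    (inj₁ refl ∷ []) (inj₂ refl ∷ []) (part₀ m) (part₁ m) (part₂ m) (total m)
  where
  part₀ : ∀ m → (2 + m) * 4 + 0 * 3 + 1 ≡ 4 * (2 + m) + 1
  part₀ = solve-∀
  part₁ : ∀ m → 2 + (suc m * 4 + 0 * 3) + 3 ≡ 4 * (2 + m) + 1
  part₁ = solve-∀
  part₂ : ∀ m → 1 + ((2 + m) * 4 + 0 * 3) ≡ 4 * (2 + m) + 1
  part₂ = solve-∀
  total : ∀ m → 2 + m + 0 + (1 + (suc m + 0 + (1 + (2 + m + 0)))) ≡ 1 + (2 + m) * 3
  total = solve-∀
... | inj₂ refl =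
  crossingColouring 3 (centreBefore 2) (centreBefore 2) (2 + m) 0 m 2 (suc m) 1 2≤3 2≤3
    (inj₁ refl ∷ []) (inj₁ refl ∷ []) (part₀ m) (part₁ m) (part₂ m) (total m)
  where
  part₀ : ∀ m → (2 + m) * 4 + 0 * 3 + 1 ≡ 4 * (2 + m) + 1
  part₀ = solve-∀
  part₁ : ∀ m → 2 + (m * 4 + 2 * 3) + 1 ≡ 4 * (2 + m) + 1
  part₁ = solve-∀
  part₂ : ∀ m → 2 + (suc m * 4 + 1 * 3) ≡ 4 * (2 + m) + 1
  part₂ = solve-∀
  total : ∀ m → 2 + m + 0 + (1 + (m + 2 + (1 + (suc m + 1)))) ≡ 2 + (2 + m) * 3
  total = solve-∀

colouring-just-above-6k : ∀ k → 1 ≤ k → ∀ t → k * 6 < t → t ≤ 2 + k * 6 →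
  HasEqTreeColoring (K3 (4 * k + 1)) 3 t
colouring-just-above-6k (suc m) (s≤s _) t lower upper with just-above lower upper
... | inj₁ refl =
  crossingColouring 2 (centreBefore 1) (centreBefore 1) 0 (suc m * 2) 1 (m * 2) 0 (suc m * 2) (s≤s z≤n) (s≤s z≤n)
    (inj₁ refl ∷ []) (inj₁ refl ∷ []) (part₀ m) (part₁ m) (part₂ m) (total m)
  where
  part₀ : ∀ m → 0 * 3 + suc m * 2 * 2 + 1 ≡ 4 * suc m + 1
  part₀ = solve-∀
  part₁ : ∀ m → 1 + (1 * 3 + m * 2 * 2) + 1 ≡ 4 * suc m + 1
  part₁ = solve-∀
  part₂ : ∀ m → 1 + (0 * 3 + suc m * 2 * 2) ≡ 4 * suc m + 1
  part₂ = solve-∀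
  total : ∀ m → 0 + suc m * 2 + (1 + (1 + m * 2 + (1 + (0 + suc m * 2)))) ≡ 1 + suc m * 6
  total = solve-∀
... | inj₂ refl =
  crossingColouring 1 (centreBefore 1) (centreBefore 1) (suc m * 2) 0 (1 + m * 2) 1 (suc m * 2) 0 (s≤s z≤n) (s≤s z≤n)
    (inj₂ refl ∷ []) (inj₂ refl ∷ []) (part₀ m) (part₁ m) (part₂ m) (total m)
  where
  part₀ : ∀ m → suc m * 2 * 2 + 0 * 1 + 1 ≡ 4 * suc m + 1
  part₀ = solve-∀
  part₁ : ∀ m → 1 + ((1 + m * 2) * 2 + 1 * 1) + 1 ≡ 4 * suc m + 1
  part₁ = solve-∀
  part₂ : ∀ m → 1 + (suc m * 2 * 2 + 0 * 1) ≡ 4 * suc m + 1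
  part₂ = solve-∀
  total : ∀ m → suc m * 2 + 0 + (1 + (1 + m * 2 + 1 + (1 + (suc m * 2 + 0)))) ≡ 2 + suc m * 6
  total = solve-∀

colouring-just-above-3d-mod1 : ∀ d → 2 ≤ d → ∀ t → d * 3 < t → t ≤ 2 + d * 3 →
  HasEqTreeColoring (K3 (1 + d * 3)) 3 t
colouring-just-above-3d-mod1 (suc (suc e)) (s≤s (s≤s _)) t lower upper with just-above lower upper
... | inj₁ refl =
  crossingColouring 2 (centreBefore 2) (centreAfter 2) (2 + e) 0 (suc e) 0 (2 + e) 0 2≤3 2≤3
    (inj₂ refl ∷ []) (inj₂ refl ∷ []) (part₀ e) (part₁ e) (part₂ e) (total e)
  where
  part₀ : ∀ e → (2 + e) * 3 + 0 * 2 + 1 ≡ 1 + (2 + e) * 3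
  part₀ = solve-∀
  part₁ : ∀ e → 2 + (suc e * 3 + 0 * 2) + 2 ≡ 1 + (2 + e) * 3
  part₁ = solve-∀
  part₂ : ∀ e → 1 + ((2 + e) * 3 + 0 * 2) ≡ 1 + (2 + e) * 3
  part₂ = solve-∀
  total : ∀ e → 2 + e + 0 + (1 + (suc e + 0 + (1 + (2 + e + 0)))) ≡ 1 + (2 + e) * 3
  total = solve-∀
... | inj₂ refl =
  crossingColouring 2 (centreBefore 2) (centreAfter 2) e 3 (suc e) 0 (2 + e) 0 2≤3 2≤3
    (inj₂ refl ∷ []) (inj₂ refl ∷ []) (part₀ e) (part₁ e) (part₂ e) (total e)
  where
  part₀ : ∀ e → e * 3 + 3 * 2 + 1 ≡ 1 + (2 + e) * 3
  part₀ = solve-∀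
  part₁ : ∀ e → 2 + (suc e * 3 + 0 * 2) + 2 ≡ 1 + (2 + e) * 3
  part₁ = solve-∀
  part₂ : ∀ e → 1 + ((2 + e) * 3 + 0 * 2) ≡ 1 + (2 + e) * 3
  part₂ = solve-∀
  total : ∀ e → e + 3 + (1 + (suc e + 0 + (1 + (2 + e + 0)))) ≡ 2 + (2 + e) * 3
  total = solve-∀

colouring-just-above-3d-mod2 : ∀ d → 3 ≤ d → ∀ t → d * 3 < t → t ≤ 2 + d * 3 →
  HasEqTreeColoring (K3 (2 + d * 3)) 3 t
colouring-just-above-3d-mod2 (suc (suc (suc e))) (s≤s (s≤s (s≤s _))) t lower upper with just-above lower upper
... | inj₁ refl =
  crossingColouring 3 (centreAfter 2) (centreBefore 3) 0 (3 + e) 0 (3 + e) 2 e 2≤3 ≤-refl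
    (inj₁ refl ∷ []) (inj₂ refl ∷ []) (part₀ e) (part₁ e) (part₂ e) (total e)
  where
  part₀ : ∀ e → 0 * 4 + (3 + e) * 3 + 2 ≡ 2 + (3 + e) * 3
  part₀ = solve-∀
  part₁ : ∀ e → 1 + (0 * 4 + (3 + e) * 3) + 1 ≡ 2 + (3 + e) * 3
  part₁ = solve-∀
  part₂ : ∀ e → 3 + (2 * 4 + e * 3) ≡ 2 + (3 + e) * 3
  part₂ = solve-∀
  total : ∀ e → 0 + (3 + e) + (1 + (0 + (3 + e) + (1 + (2 + e)))) ≡ 1 + (3 + e) * 3
  total = solve-∀
... | inj₂ refl =
  crossingColouring 3 (centreAfter 2) (centreBefore 2) 0 (3 + e) 0 (3 + e) 0 (3 + e) 2≤3 2≤3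
    (inj₁ refl ∷ []) (inj₁ refl ∷ []) (part₀ e) (part₁ e) (part₂ e) (total e)
  where
  part₀ : ∀ e → 0 * 4 + (3 + e) * 3 + 2 ≡ 2 + (3 + e) * 3
  part₀ = solve-∀
  part₁ : ∀ e → 1 + (0 * 4 + (3 + e) * 3) + 1 ≡ 2 + (3 + e) * 3
  part₁ = solve-∀
  part₂ : ∀ e → 2 + (0 * 4 + (3 + e) * 3) ≡ 2 + (3 + e) * 3
  part₂ = solve-∀
  total : ∀ e → 0 + (3 + e) + (1 + (0 + (3 + e) + (1 + (0 + (3 + e))))) ≡ 2 + (3 + e) * 3
  total = solve-∀

colouring-just-above-3d : ∀ r d → r < 3 → 3 ≤ d → ∀ t → d * 3 < t → t ≤ 2 + d * 3 →
  HasEqTreeColoring (K3 (r + d * 3)) 3 t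
colouring-just-above-3d 0 d@(suc (suc (suc e))) _ (s≤s (s≤s (s≤s _))) t lower upper =
  uniformColouring 2 {lo = d} {hi = suc d} ≤-refl (m+n≡o⇒m≤o (suc e) (slack e)) (<⇒≤ lower) (m≤n⇒m≤1+n upper)
  where
  slack : ∀ e → (4 + e) * 2 + suc e ≡ (3 + e) * 3
  slack = solve-∀
colouring-just-above-3d 1 d _ 3≤d = colouring-just-above-3d-mod1 d (≤-trans (n≤1+n 2) 3≤d)
colouring-just-above-3d 2 d _ 3≤d = colouring-just-above-3d-mod2 d 3≤d
colouring-just-above-3d (suc (suc (suc r))) d (s≤s (s≤s (s≤s ()))) _

3≤quotient : ∀ {r d} → r < 3 → 9 ≤ r + d * 3 → 3 ≤ d
3≤quotient {r} {d} r<3 9≤n with 3 ≤? d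
... | yes 3≤d = 3≤d
... | no 3≰d = ⊥-elim (1+n≰n (≤-trans 9≤n (+-mono-≤ (≤-pred r<3) (*-monoˡ-≤ 3 (≤-pred (≰⇒> 3≰d))))))

colouring-between-3k-and-6k : ∀ k r d → r < 3 → 4 * k + 1 ≡ r + d * 3 → 2 ≤ k →
  ∀ t → suc k * 3 ≤ t → t ≤ k * 6 → HasEqTreeColoring (K3 (4 * k + 1)) 3 t
colouring-between-3k-and-6k k r d r<3 n≡ 2≤k t lower upper with t ≤? d * 3 | t ≤? 2 + d * 3
... | yes t≤3d | _ =
  uniformColouring 3 {suc k} {d} (m+n≡o⇒m≤o 3 (slack k)) (subst (d * 3 ≤_) (sym n≡) (m≤n+m (d * 3) r)) lower t≤3d
  where
  slack : ∀ k → 4 * k + 1 + 3 ≡ suc k * 4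
  slack = solve-∀
... | no t≰3d | yes t≤3d+2 =
  subst (λ n → HasEqTreeColoring (K3 n) 3 t) (sym n≡) (colouring-just-above-3d r d r<3 3≤d t (≰⇒> t≰3d) t≤3d+2)
  where
  3≤d : 3 ≤ d
  3≤d = 3≤quotient r<3 (subst (9 ≤_) n≡ (+-monoˡ-≤ 1 (*-monoʳ-≤ 4 2≤k)))
... | no _ | no t≰3d+2 =
  uniformColouring 2 {suc d} {k * 2} (subst (_≤ suc d * 3) (sym n≡) (+-monoˡ-≤ (d * 3) (<⇒≤ r<3)))
    (m+n≡o⇒m≤o 1 (slack k)) (≰⇒> t≰3d+2) (subst (t ≤_) (sym (*-assoc k 2 3)) upper)
  where
  slack : ∀ k → k * 2 * 2 + 1 ≡ 4 * k + 1
  slack = solve-∀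

colouring-beyond-3k : ∀ k → 2 ≤ k → ∀ t → k * 3 < t → HasEqTreeColoring (K3 (4 * k + 1)) 3 t
colouring-beyond-3k k 2≤k t 3k<t with t ≤? 2 + k * 3 | t ≤? k * 6 | t ≤? 2 + k * 6 | t ≤? (4 * k + 1) * 3
... | yes t≤3k+2 | _ | _ | _ = colouring-just-above-3k k 2≤k t 3k<t t≤3k+2
... | no t≰3k+2 | yes t≤6k | _ | _ =
  colouring-between-3k-and-6k k ((4 * k + 1) % 3) ((4 * k + 1) / 3) (m%n<n (4 * k + 1) 3)
    (m≡m%n+[m/n]*n (4 * k + 1) 3) 2≤k t (≰⇒> t≰3k+2) t≤6k
... | no _ | no t≰6k | yes t≤6k+2 | _ = colouring-just-above-6k k (≤-trans (n≤1+n 1) 2≤k) t (≰⇒> t≰6k) t≤6k+2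
... | no _ | no _ | no t≰6k+2 | yes t≤3n =
  uniformColouring 1 {1 + k * 2} {4 * k + 1} (m+n≡o⇒m≤o 1 (slack k)) (≤-reflexive (*-identityʳ _))
    (subst (_≤ t) (cong (3 +_) (sym (*-assoc k 2 3))) (≰⇒> t≰6k+2)) t≤3n
  where
  slack : ∀ k → 4 * k + 1 + 1 ≡ (1 + k * 2) * 2
  slack = solve-∀
... | no _ | no _ | no _ | no t≰3n =
  uniformColouring 0 {4 * k + 1} {t} (≤-reflexive (sym (*-identityʳ _))) (subst (_≤ 4 * k + 1) (sym (*-zeroʳ t)) z≤n)
    (<⇒≤ (≰⇒> t≰3n)) (m≤m*n t 3)

K3-strongEqVA≤ : ∀ k lo → 2 ≤ k → 4 * k + 1 ≤ lo * 5 → StrongEqVA≤ (K3 (4 * k + 1)) 3 (lo * 3)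
K3-strongEqVA≤ k lo 2≤k n≤5lo t lo*3≤t with t ≤? k * 3
... | yes t≤3k = uniformColouring 4 {lo} {k} n≤5lo (m+n≡o⇒m≤o 1 (cong (_+ 1) (*-comm k 4))) lo*3≤t t≤3k
... | no t≰3k = colouring-beyond-3k k 2≤k t (≰⇒> t≰3k)

K3-strongEqVA≤-by-residue : ∀ {k} r c s (lo : ℕ → ℕ) → k % 5 ≡ r → 2 ≤ k →
  (∀ j → 4 * (r + j * 5) + 1 + s ≡ lo j * 5) → (∀ j → 12 * (r + j * 5) + c ≡ lo j * 3 * 5) →
  StrongEqVA≤ (K3 (4 * k + 1)) 3 ((12 * k + c) / 5)
K3-strongEqVA≤-by-residue {k} r c s lo k%5≡r 2≤k n≤ bound≡ =
  subst (StrongEqVA≤ (K3 (4 * k + 1)) 3) (sym bound≡lo*3)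
    (K3-strongEqVA≤ k (lo j) 2≤k (subst (λ k → 4 * k + 1 ≤ lo j * 5) (sym k≡) (m+n≡o⇒m≤o s (n≤ j))))
  where
  j : ℕ
  j = k / 5
  k≡ : k ≡ r + j * 5
  k≡ = trans (m≡m%n+[m/n]*n k 5) (cong (_+ j * 5) k%5≡r)
  bound≡lo*3 : (12 * k + c) / 5 ≡ lo j * 3
  bound≡lo*3 = trans (cong (λ k → (12 * k + c) / 5) k≡) (trans (cong (_/ 5) (bound≡ j)) (m*n/n≡m (lo j * 3) 5))

corollary2 : ∀ (k : ℕ) → .{{_ : NonZero k}} →
    ((k % 5 ≡ 2 → StrongEqVA≤ (K3 (4 * k + 1)) 3 ((12 * k + 6) / 5)) ×
     (k % 5 ≡ 3 → StrongEqVA≤ (K3 (4 * k + 1)) 3 ((12 * k + 9) / 5)) ×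
     (k % 5 ≡ 4 → StrongEqVA≤ (K3 (4 * k + 1)) 3 ((12 * k + 12) / 5)) ×
     (k % 5 ≡ 0 → StrongEqVA≤ (K3 (4 * k + 1)) 3 ((12 * k + 15) / 5)))
corollary2 k =
  (λ k%5≡2 → K3-strongEqVA≤-by-residue 2 6 1 (λ j → 4 * j + 2) k%5≡2 (2≤k-of 2≤2 k%5≡2) fits₂ bound₂) ,
  (λ k%5≡3 → K3-strongEqVA≤-by-residue 3 9 2 (λ j → 4 * j + 3) k%5≡3 (2≤k-of 2≤3 k%5≡3) fits₃ bound₃) ,
  (λ k%5≡4 → K3-strongEqVA≤-by-residue 4 12 3 (λ j → 4 * j + 4) k%5≡4 (2≤k-of 2≤4 k%5≡4) fits₄ bound₄) ,
  (λ k%5≡0 → K3-strongEqVA≤-by-residue 0 15 4 (λ j → 4 * j + 1) k%5≡0 (2≤5k k%5≡0) fits₀ bound₀)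
  where
  2≤2 : 2 ≤ 2
  2≤2 = ≤-refl
  2≤4 : 2 ≤ 4
  2≤4 = m≤m+n 2 2
  2≤k-of : ∀ {r} → 2 ≤ r → k % 5 ≡ r → 2 ≤ k
  2≤k-of 2≤r refl = ≤-trans 2≤r (m%n≤m k 5)
  2≤5k : k % 5 ≡ 0 → 2 ≤ k
  2≤5k k%5≡0 = ≤-trans (m≤m+n 2 3) (∣⇒≤ (m%n≡0⇒n∣m k 5 k%5≡0))
  fits₂ : ∀ j → 4 * (2 + j * 5) + 1 + 1 ≡ (4 * j + 2) * 5
  fits₂ = solve-∀
  bound₂ : ∀ j → 12 * (2 + j * 5) + 6 ≡ (4 * j + 2) * 3 * 5
  bound₂ = solve-∀
  fits₃ : ∀ j → 4 * (3 + j * 5) + 1 + 2 ≡ (4 * j + 3) * 5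
  fits₃ = solve-∀
  bound₃ : ∀ j → 12 * (3 + j * 5) + 9 ≡ (4 * j + 3) * 3 * 5
  bound₃ = solve-∀
  fits₄ : ∀ j → 4 * (4 + j * 5) + 1 + 3 ≡ (4 * j + 4) * 5
  fits₄ = solve-∀
  bound₄ : ∀ j → 12 * (4 + j * 5) + 12 ≡ (4 * j + 4) * 3 * 5
  bound₄ = solve-∀
  fits₀ : ∀ j → 4 * (0 + j * 5) + 1 + 4 ≡ (4 * j + 1) * 5
  fits₀ = solve-∀
  bound₀ : ∀ j → 12 * (0 + j * 5) + 15 ≡ (4 * j + 1) * 3 * 5
  bound₀ = solve-∀
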